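{- Let $\Gamma$ be a connected $r$-regular simple graph on $n\ge2$ vertices, with adjacency matrix $A$ and degree matrix $D$, and let $\mathcal{R}=D^{ -1}A$. For vertices $i\neq k$ let $N(i,k)$ be the number of common neighbours of $i$ and $k$, and define $$\gamma_{ik}=\begin{cases}1+2N(i,k), & k\sim i,\\ 2N(i,k), & k\nsim i,\end{cases}\qquad \delta_{ik}=\begin{cases}3+2N(i,k), & k\sim i,\\ 2N(i,k), & k\nsim i.\end{cases}$$ If $\lambda\ne1$ is any eigenvalue of $\mathcal{R}$, then $$-2+\frac1r\max\Big(\{1\}\cup\{\min_{k\ne i}\gamma_{ik}: i\in V(\Gamma)\}\Big)\le\lambda\le 2-\frac1r\max\Big(\{1\}\cup\{\min_{k\ne i}\delta_{ik}: i\in V(\Gamma)\}\Big).$$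
   Context: $k\sim i$ means vertices $k$ and $i$ are adjacent. -}

module Defs where

open import Level using (Level) renaming (suc to lsuc; _⊔_ to _⊔ℓ_)
open import Data.Bool using (Bool; true; false; if_then_else_; _∧_)
open import Data.Nat as ℕ using (ℕ; zero; suc; _⊓_; _⊔_)
open import Data.Fin using (Fin; zero; suc)
open import Data.List using (List; []; _∷_; map; filter; foldr)
open import Data.Fin.Properties using () renaming (_≟_ to _≟F_)
open import Data.List.Base using ()
open import Data.Product using (Σ; ∃; _×_; _,_)
open import Relation.Nullary using (¬_)
open import Relation.Nullary.Decidable using (¬?)
open import Relation.Binary.PropositionalEquality using (_≡_)
open import Relation.Binary using (Rel; IsTotalOrder)
open import Algebra.Bundles using (CommutativeRing)
open import Data.List.Base using (allFin) public

record SimpleGraph (n : ℕ) : Set where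
  field
    Adj    : Fin n → Fin n → Bool
    sym    : ∀ i k → Adj i k ≡ Adj k i
    irrefl : ∀ i → Adj i i ≡ false

module _ {n : ℕ} (G : SimpleGraph n) where
  open SimpleGraph G

  countF : (Fin n → Bool) → ℕ
  countF p = foldr (λ j acc → if p j then suc acc else acc) 0 (allFin n)

  degree : Fin n → ℕ
  degree i = countF (Adj i)

  IsRegular : ℕ → Set
  IsRegular r = ∀ i → degree i ≡ r

  data Reach : Fin n → Fin n → Set where
    here  : ∀ {i} → Reach i i
    there : ∀ {i k j} → Adj i k ≡ true → Reach k j → Reach i j

  Connected : Set
  Connected = ∀ i j → Reach i j

  commonNbrs : Fin n → Fin n → ℕ
  commonNbrs i k = countF (λ j → Adj i j ∧ Adj k j)

  γ : Fin n → Fin n → ℕ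
  γ i k = if Adj i k then 1 ℕ.+ 2 ℕ.* commonNbrs i k else 2 ℕ.* commonNbrs i k

  δ : Fin n → Fin n → ℕ
  δ i k = if Adj i k then 3 ℕ.+ 2 ℕ.* commonNbrs i k else 2 ℕ.* commonNbrs i k

  -- minimum of a list (only used on nonempty lists; [] ↦ 0 is irrelevant)
  minList : List ℕ → ℕ
  minList []       = 0
  minList (x ∷ xs) = foldr _⊓_ x xs

  minOthers : (Fin n → Fin n → ℕ) → Fin n → ℕ
  minOthers f i = minList (map (f i) (filter (λ k → ¬? (k ≟F i)) (allFin n)))

  maxMin : (Fin n → Fin n → ℕ) → ℕ
  maxMin f = foldr _⊔_ 1 (map (minOthers f) (allFin n))

  Mγ : ℕ
  Mγ = maxMin γ

  Mδ : ℕ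
  Mδ = maxMin δ

-- Ordered fields (the stdlib has no reals; we work over an arbitrary
-- ordered field, ℝ being the case of the paper)

record OrderedField c ℓ : Set (lsuc (c ⊔ℓ ℓ)) where
  field
    commutativeRing : CommutativeRing c ℓ
  open CommutativeRing commutativeRing public
  field
    _⁻¹         : Carrier → Carrier
    ⁻¹-inverse  : ∀ x → ¬ (x ≈ 0#) → x * (x ⁻¹) ≈ 1#
    0≉1         : ¬ (0# ≈ 1#)
    _≤_         : Rel Carrier ℓ
    isTotalOrder : IsTotalOrder _≈_ _≤_
    +-mono-≤    : ∀ {x y} z → x ≤ y → (x + z) ≤ (y + z)
    *-nonneg    : ∀ {x y} → 0# ≤ x → 0# ≤ y → 0# ≤ (x * y)

module FieldOps {c ℓ} (F : OrderedField c ℓ) where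
  open OrderedField F hiding (zero)

  fromℕ : ℕ → Carrier
  fromℕ zero    = 0#
  fromℕ (suc m) = 1# + fromℕ m

  Σ[_] : ∀ {m} → (Fin m → Carrier) → Carrier
  Σ[_] {zero}  f = 0#
  Σ[_] {suc m} f = f zero + Σ[_] {m} (λ j → f (suc j))

  module _ {n : ℕ} (G : SimpleGraph n) where
    open SimpleGraph G

    adjMatrix : Fin n → Fin n → Carrier
    adjMatrix i j = if Adj i j then 1# else 0#

    degMatrix : Fin n → Fin n → Carrier
    degMatrix i j = if ⌊ i ≟F j ⌋ then fromℕ (degree G i) else 0#
      where open import Relation.Nullary.Decidable using (⌊_⌋)

    -- D is diagonal, so D⁻¹ is the diagonal matrix of inverses of its
    -- diagonal entries, and (D⁻¹ A) i j = (D i i)⁻¹ * A i j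
    R : Fin n → Fin n → Carrier
    R i j = (degMatrix i i ⁻¹) * adjMatrix i j

    IsEigenvalueR : Carrier → Set (c ⊔ℓ ℓ)
    IsEigenvalueR λ′ =
      Σ (Fin n → Carrier) λ v →
        (∃ λ j → ¬ (v j ≈ 0#)) ×
        (∀ i → Σ[ (λ j → R i j * v j) ] ≈ (λ′ * v i))

module Submission where

open import Defs
open import Data.Nat using (ℕ; _≥_)
open import Relation.Nullary using (¬_)
open import Data.Product using (_×_)

open import Algebra.Bundles using (Semiring)
open import Data.Bool using (Bool; true; false; if_then_else_; _∧_; _∨_; not)
open import Data.Fin using (Fin; zero; suc)
open import Data.Fin.Properties using (_≟_)
open import Data.List using (_∷_; foldr; tabulate; allFin)
import Data.List.Relation.Unary.All as All
open import Data.List.Membership.Propositional.Properties using (∈-allFin)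
import Data.Nat as ℕ
import Data.Nat.Properties as ℕ
open import Data.Product using (_,_; proj₁; proj₂; ∃)
open import Data.Sum using (_⊎_; inj₁; inj₂; [_,_]′)
open import Function using (_∘_; id; case_of_)
open import Relation.Binary.Bundles using (Poset; TotalOrder)
open import Relation.Binary.Structures using (IsTotalOrder)
open import Relation.Binary.PropositionalEquality as ≡ using (_≡_; _≢_)
import Relation.Binary.Reasoning.PartialOrder as PartialOrderReasoning
open import Relation.Nullary.Decidable using (does; dec-true; dec-false)

-- Write A for the adjacency matrix, so that λ is an eigenvalue of R = D⁻¹A = A/r
-- exactly when μ = rλ is one of A. As A is symmetric with all row sums r and
-- μ ≠ r, an eigenvector v sums to 0; since A + Ā + I = J, it is then also an
-- eigenvector of the adjacency matrix Ā of the complement, with eigenvalue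
-- −(1 + μ). Gershgorin's argument at an entry of v of largest modulus gives
-- |μ| ≤ r and |1 + μ| ≤ T, where T = n − 1 − r is the degree of the complement.
--
-- Combinatorially, fix a vertex i and let m = min_{k≠i} (c·[k∼i] + 2N(i,k)), with
-- c = 1 for γ and c = 3 for δ. Every non-neighbour k ≠ i has 2N(i,k) ≥ m, and every
-- neighbour j of i has r = 1 + N(i,j) + #{k ∼ j : k ≁ i, k ≠ i} and c + 2N(i,j) ≥ m;
-- counting the paths i ∼ j ∼ k with k ≁ i, k ≠ i in two ways therefore gives
-- T m ≤ r (2r + c − m − 2), so m ≥ r forces T + m + 2 ≤ 2r + c. Together with the
-- two Gershgorin bounds this yields m ≤ 2r + μ for c = 1 and m ≤ 2r − μ for c = 3
-- (directly from |μ| ≤ r when m ≤ r), and dividing by r gives the theorem.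

module _ {n : ℕ} (G : SimpleGraph n) where
  open SimpleGraph G

  nonAdj : Fin n → Fin n → Bool
  nonAdj i k = not (Adj i k ∨ does (k ≟ i))

  adj⇒≢ : ∀ {i k} → Adj i k ≡ true → k ≢ i
  adj⇒≢ {i} ik ≡.refl = case ≡.trans (≡.sym ik) (irrefl i) of λ ()

  nonAdj⇒¬Adj∧≢ : ∀ {i k} → nonAdj i k ≡ true → Adj i k ≡ false × k ≢ i
  nonAdj⇒¬Adj∧≢ {i} {k} ik =
    let ¬ik , k≟i≡false = nor (Adj i k) (does (k ≟ i)) ik
    in ¬ik , λ k≡i → case ≡.trans (≡.sym k≟i≡false) (dec-true (k ≟ i) k≡i) of λ ()
    where
    nor : ∀ a e → not (a ∨ e) ≡ true → a ≡ false × e ≡ false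
    nor false false _ = ≡.refl , ≡.refl
    nor false true  ()
    nor true  _     ()

module IndicatorSums {c ℓ} (S : Semiring c ℓ) where
  open Semiring S hiding (zero)
  open import Algebra.Properties.Semiring.Sum S public
    using (sum; sum-cong-≋; sum-cong-≗; sum-replicate-zero; ∑-distrib-+; ∑-comm; *-distribˡ-sum)
  open import Relation.Binary.Reasoning.Setoid setoid

  when : Bool → Carrier → Carrier
  when b x = if b then x else 0#

  when-∧ : ∀ a b x → when (a ∧ b) x ≈ when a (when b x)
  when-∧ true  b x = refl
  when-∧ false b x = refl

  when-sum : ∀ {n} b (f : Fin n → Carrier) → when b (sum f) ≈ sum (λ k → when b (f k))
  when-sum     true  f = refl
  when-sum {n} false f = sym (sum-replicate-zero n)

  -- `does` rather than `⌊_⌋`: it computes through the `map′` in the `suc` case of `_≟_`.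
  sum-when-≟ : ∀ {n} (j : Fin n) (f : Fin n → Carrier) → sum (λ k → when (does (k ≟ j)) (f k)) ≈ f j
  sum-when-≟ {ℕ.suc n} zero    f = trans (+-congˡ (sum-replicate-zero n)) (+-identityʳ (f zero))
  sum-when-≟           (suc j) f = trans (+-identityˡ _) (sum-when-≟ j (f ∘ suc))

  when-partition : ∀ a e x → (a ≡ true → e ≡ false) → when a x + when (not (a ∨ e)) x + when e x ≈ x
  when-partition true  true  x a⇒¬e with () ← a⇒¬e ≡.refl
  when-partition true  false x _ = trans (+-identityʳ _) (+-identityʳ x)
  when-partition false true  x _ = trans (+-congʳ (+-identityˡ 0#)) (+-identityˡ x)
  when-partition false false x _ = trans (+-identityʳ _) (+-identityˡ x)

  sum-split-closedNbhd : ∀ {n} (G : SimpleGraph n) i (f : Fin n → Carrier) →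
    sum (λ k → when (SimpleGraph.Adj G i k) (f k)) + sum (λ k → when (nonAdj G i k) (f k)) + f i ≈ sum f
  sum-split-closedNbhd {n} G i f = begin
    sum A + sum N + f i            ≈⟨ +-congˡ (sym (sum-when-≟ i f)) ⟩
    sum A + sum N + sum E          ≈⟨ +-congʳ (sym (∑-distrib-+ A N)) ⟩
    sum (λ k → A k + N k) + sum E  ≈⟨ sym (∑-distrib-+ (λ k → A k + N k) E) ⟩
    sum (λ k → A k + N k + E k)    ≈⟨ sum-cong-≋ partition ⟩
    sum f                          ∎
    where
    A N E : Fin n → Carrier
    A k = when (SimpleGraph.Adj G i k) (f k)
    N k = when (nonAdj G i k) (f k)
    E k = when (does (k ≟ i)) (f k)
    partition : ∀ k → A k + N k + E k ≈ f k
    partition k = when-partition _ _ (f k) (dec-false (k ≟ i) ∘ adj⇒≢ G)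

module NatSums where
  open import Data.Nat using (_+_; _*_; _≤_; z≤n; s≤s)
  open import Data.Nat.Properties using (+-*-semiring; +-mono-≤; ≤-trans; m≤n+m)
  open IndicatorSums +-*-semiring public
  open ≡ using (refl; cong)

  count : ∀ {n} → (Fin n → Bool) → ℕ
  count p = sum (λ k → when (p k) 1)

  count-true : ∀ n → count {n} (λ _ → true) ≡ n
  count-true ℕ.zero    = refl
  count-true (ℕ.suc n) = cong ℕ.suc (count-true n)

  count-pos : ∀ {n} (p : Fin n → Bool) {k} → p k ≡ true → 1 ≤ count p
  count-pos p {zero}  pk rewrite pk = s≤s z≤n
  count-pos p {suc k} pk = ≤-trans (count-pos (p ∘ suc) pk) (m≤n+m _ (when (p zero) 1))

  sum-when-const : ∀ {n} (p : Fin n → Bool) m → sum (λ k → when (p k) m) ≡ count p * m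
  sum-when-const {ℕ.zero}  p m = refl
  sum-when-const {ℕ.suc n} p m with p zero
  ... | true  = cong (m +_) (sum-when-const (p ∘ suc) m)
  ... | false = sum-when-const (p ∘ suc) m

  sum-mono-≤ : ∀ {n} {f g : Fin n → ℕ} → (∀ k → f k ≤ g k) → sum f ≤ sum g
  sum-mono-≤ {ℕ.zero}  f≤g = z≤n
  sum-mono-≤ {ℕ.suc n} f≤g = +-mono-≤ (f≤g zero) (sum-mono-≤ (f≤g ∘ suc))

module MinMax {n : ℕ} (G : SimpleGraph n) where
  open import Data.Nat using (_≤_; _⊓_; _⊔_)
  open import Data.Nat.Properties using (≤-reflexive; m≤n⇒m⊓o≤n; m≤n⇒o⊓m≤n; ⊔-sel)
  open import Data.List.Properties using (foldr-preservesᵒ; foldr-preservesᵇ)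
  open import Data.List.Relation.Unary.Any as Any using (Any; here; there)
  open import Data.List.Relation.Unary.All.Properties using (map⁺)
  open import Data.List.Membership.Propositional using (_∈_)
  open import Data.List.Membership.Propositional.Properties using (∈-map⁺; ∈-filter⁺)
  open import Relation.Nullary.Decidable using (¬?)

  minList-≤ : ∀ {y} xs → y ∈ xs → minList G xs ≤ y
  minList-≤ {y} (x ∷ xs) y∈x∷xs = foldr-preservesᵒ {P = _≤ y} ⊓-pres x xs (head-or-tail y∈x∷xs)
    where
    ⊓-pres : ∀ a b → a ≤ y ⊎ b ≤ y → a ⊓ b ≤ y
    ⊓-pres a b (inj₁ a≤y) = m≤n⇒m⊓o≤n b a≤y
    ⊓-pres a b (inj₂ b≤y) = m≤n⇒o⊓m≤n a b≤y
    head-or-tail : ∀ {z zs} → y ∈ z ∷ zs → z ≤ y ⊎ Any (_≤ y) zs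
    head-or-tail (here y≡z)   = inj₁ (≤-reflexive (≡.sym y≡z))
    head-or-tail (there y∈zs) = inj₂ (Any.map (λ y≡z → ≤-reflexive (≡.sym y≡z)) y∈zs)

  minOthers-≤ : ∀ f i k → k ≢ i → minOthers G f i ≤ f i k
  minOthers-≤ f i k k≢i =
    minList-≤ _ (∈-map⁺ (f i) (∈-filter⁺ (λ k → ¬? (k ≟ i)) (∈-allFin k) k≢i))

  maxMin-preserves : ∀ {p} (P : ℕ → Set p) f → P 1 → (∀ i → P (minOthers G f i)) → P (maxMin G f)
  maxMin-preserves P f P1 Pmin = foldr-preservesᵇ {P = P} ⊔-pres P1 (map⁺ (All.universal Pmin (allFin n)))
    where
    ⊔-pres : ∀ {a b} → P a → P b → P (a ⊔ b)
    ⊔-pres {a} {b} Pa Pb with ⊔-sel a b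
    ... | inj₁ a⊔b≡a = ≡.subst P (≡.sym a⊔b≡a) Pa
    ... | inj₂ a⊔b≡b = ≡.subst P (≡.sym a⊔b≡b) Pb

module Counting {n : ℕ} (G : SimpleGraph n) where
  open SimpleGraph G renaming (sym to Adj-sym)
  open NatSums
  open MinMax G using (minOthers-≤)
  open import Data.Nat using (_+_; _*_; _≤_; z≤n; >-nonZero)
  open import Data.Nat.Properties
  open import Data.Nat.Tactic.RingSolver using (solve-∀)
  open ≡ using (refl; sym; trans; cong; cong₂; subst)

  countF≡count : ∀ p → countF G p ≡ count p
  countF≡count p = foldr-tabulate id
    where
    foldr-tabulate : ∀ {m} (g : Fin m → Fin n) →
      foldr (λ j acc → if p j then ℕ.suc acc else acc) 0 (tabulate g) ≡ count (p ∘ g)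
    foldr-tabulate {ℕ.zero}  g = refl
    foldr-tabulate {ℕ.suc m} g with p (g zero)
    ... | true  = cong ℕ.suc (foldr-tabulate (g ∘ suc))
    ... | false = foldr-tabulate (g ∘ suc)

  degree-pos : ∀ {i k} → Adj i k ≡ true → 1 ≤ degree G i
  degree-pos {i} ik = subst (1 ≤_) (sym (countF≡count (Adj i))) (count-pos (Adj i) ik)

  coDegree : Fin n → ℕ
  coDegree i = count (nonAdj G i)

  beyond : Fin n → Fin n → ℕ
  beyond i j = count (λ k → nonAdj G i k ∧ Adj j k)

  degree+coDegree : ∀ i → degree G i + coDegree i + 1 ≡ n
  degree+coDegree i = begin
    degree G i + coDegree i + 1     ≡⟨ cong (λ d → d + coDegree i + 1) (countF≡count (Adj i)) ⟩
    count (Adj i) + coDegree i + 1  ≡⟨ sum-split-closedNbhd G i (λ _ → 1) ⟩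
    count {n} (λ _ → true)          ≡⟨ count-true n ⟩
    n                               ∎
    where open ≡.≡-Reasoning

  coDegree-regular : ∀ {r} → IsRegular G r → ∀ i j → coDegree i ≡ coDegree j
  coDegree-regular {r} regular i j = +-cancelˡ-≡ r _ _ (+-cancelʳ-≡ 1 _ _ (begin
    r + coDegree i + 1           ≡⟨ cong (λ d → d + coDegree i + 1) (regular i) ⟨
    degree G i + coDegree i + 1  ≡⟨ degree+coDegree i ⟩
    n                            ≡⟨ degree+coDegree j ⟨
    degree G j + coDegree j + 1  ≡⟨ cong (λ d → d + coDegree j + 1) (regular j) ⟩
    r + coDegree j + 1           ∎))
    where open ≡.≡-Reasoning

  degree-split : ∀ {i j} → Adj i j ≡ true → commonNbrs G i j + beyond i j + 1 ≡ degree G j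
  degree-split {i} {j} ij = begin
    commonNbrs G i j + beyond i j + 1
      ≡⟨ cong₂ _+_ (cong₂ _+_ (trans (countF≡count _) (split (Adj i))) (split (nonAdj G i)))
                   (cong (λ b → when b 1) (sym (trans (Adj-sym j i) ij))) ⟩
    sum (λ k → when (Adj i k) (Nj k)) + sum (λ k → when (nonAdj G i k) (Nj k)) + Nj i
      ≡⟨ sum-split-closedNbhd G i Nj ⟩
    count (Adj j)
      ≡⟨ countF≡count (Adj j) ⟨
    degree G j ∎
    where
    open ≡.≡-Reasoning
    Nj : Fin n → ℕ
    Nj k = when (Adj j k) 1
    split : ∀ p → count (λ k → p k ∧ Adj j k) ≡ sum (λ k → when (p k) (Nj k))
    split p = sum-cong-≋ (λ k → when-∧ (p k) (Adj j k) 1)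

  outerPaths : Fin n → ℕ
  outerPaths i = sum (λ k → when (nonAdj G i k) (commonNbrs G i k))

  double-count : ∀ i → outerPaths i ≡ sum (λ j → when (Adj i j) (beyond i j))
  double-count i = begin
    sum (λ k → when (nonAdj G i k) (commonNbrs G i k))
      ≡⟨ sum-cong-≋ (λ k → trans (cong (when (nonAdj G i k)) (countF≡count _))
                                 (when-sum (nonAdj G i k) (λ j → when (Adj i j ∧ Adj k j) 1))) ⟩
    sum (λ k → sum (λ j → when (nonAdj G i k) (when (Adj i j ∧ Adj k j) 1)))
      ≡⟨ ∑-comm (λ k j → when (nonAdj G i k) (when (Adj i j ∧ Adj k j) 1)) ⟩
    sum (λ j → sum (λ k → when (nonAdj G i k) (when (Adj i j ∧ Adj k j) 1)))
      ≡⟨ sum-cong-≋ (λ j → trans (sum-cong-≋ (λ k → when-swap (nonAdj G i k) (Adj i j) (Adj-sym k j)))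
                                 (sym (when-sum (Adj i j) (λ k → when (nonAdj G i k ∧ Adj j k) 1)))) ⟩
    sum (λ j → when (Adj i j) (beyond i j)) ∎
    where
    open ≡.≡-Reasoning
    when-swap : ∀ a b {c c′} → c ≡ c′ → when a (when (b ∧ c) 1) ≡ when b (when (a ∧ c′) 1)
    when-swap true  true  refl = refl
    when-swap true  false refl = refl
    when-swap false true  refl = refl
    when-swap false false refl = refl

  count-Adj : ∀ {r} → IsRegular G r → ∀ i → count (Adj i) ≡ r
  count-Adj regular i = trans (sym (countF≡count (Adj i))) (regular i)

  -- γ G and δ G are, definitionally, weight 1 and weight 3
  weight : ℕ → Fin n → Fin n → ℕ
  weight c i k = if Adj i k then c + 2 * commonNbrs G i k else 2 * commonNbrs G i k

  weight-adj : ∀ c {i k} → Adj i k ≡ true → weight c i k ≡ c + 2 * commonNbrs G i k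
  weight-adj c {i} {k} ik = cong (λ b → if b then c + 2 * commonNbrs G i k else 2 * commonNbrs G i k) ik

  weight-nonAdj : ∀ c {i k} → Adj i k ≡ false → weight c i k ≡ 2 * commonNbrs G i k
  weight-nonAdj c {i} {k} i≁k = cong (λ b → if b then c + 2 * commonNbrs G i k else 2 * commonNbrs G i k) i≁k

  module _ (c m : ℕ) (i : Fin n) (m≤weight : ∀ k → k ≢ i → m ≤ weight c i k) where

    coDegree*m≤2*outerPaths : coDegree i * m ≤ 2 * outerPaths i
    coDegree*m≤2*outerPaths = begin
      coDegree i * m                                          ≡⟨ sum-when-const (nonAdj G i) m ⟨
      sum (λ k → when (nonAdj G i k) m)                       ≤⟨ sum-mono-≤ pointwise ⟩
      sum (λ k → 2 * when (nonAdj G i k) (commonNbrs G i k))  ≡⟨ *-distribˡ-sum 2 (λ k → when (nonAdj G i k) (commonNbrs G i k)) ⟨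
      2 * outerPaths i                                        ∎
      where
      open ≤-Reasoning
      pointwise : ∀ k → when (nonAdj G i k) m ≤ 2 * when (nonAdj G i k) (commonNbrs G i k)
      pointwise k with nonAdj G i k in i≁k
      ... | false = z≤n
      ... | true with ¬ik , k≢i ← nonAdj⇒¬Adj∧≢ G i≁k = subst (m ≤_) (weight-nonAdj c ¬ik) (m≤weight k k≢i)

    2*outerPaths+r*[m+2]≤r*[2r+c] : ∀ {r} → IsRegular G r → 2 * outerPaths i + r * (m + 2) ≤ r * (2 * r + c)
    2*outerPaths+r*[m+2]≤r*[2r+c] {r} regular = begin
      2 * outerPaths i + r * (m + 2)
        ≡⟨ cong₂ (λ s d → 2 * s + d * (m + 2)) (double-count i) (sym (count-Adj regular i)) ⟩
      2 * sum (λ j → when (Adj i j) (beyond i j)) + count (Adj i) * (m + 2)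
        ≡⟨ cong₂ _+_ (*-distribˡ-sum 2 (λ j → when (Adj i j) (beyond i j)))
                     (sym (sum-when-const (Adj i) (m + 2))) ⟩
      sum (λ j → 2 * when (Adj i j) (beyond i j)) + sum (λ j → when (Adj i j) (m + 2))
        ≡⟨ ∑-distrib-+ (λ j → 2 * when (Adj i j) (beyond i j)) (λ j → when (Adj i j) (m + 2)) ⟨
      sum (λ j → 2 * when (Adj i j) (beyond i j) + when (Adj i j) (m + 2))
        ≤⟨ sum-mono-≤ pointwise ⟩
      sum (λ j → when (Adj i j) (2 * r + c))
        ≡⟨ trans (sum-when-const (Adj i) (2 * r + c)) (cong (_* (2 * r + c)) (count-Adj regular i)) ⟩
      r * (2 * r + c) ∎
      where
      open ≤-Reasoning
      rearrange : ∀ b c N → 2 * b + (c + 2 * N + 2) ≡ 2 * (N + b + 1) + c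
      rearrange = solve-∀
      pointwise : ∀ j → 2 * when (Adj i j) (beyond i j) + when (Adj i j) (m + 2) ≤ when (Adj i j) (2 * r + c)
      pointwise j with Adj i j in ij
      ... | false = z≤n
      ... | true  = begin
        2 * beyond i j + (m + 2)          ≤⟨ +-monoʳ-≤ (2 * beyond i j) (+-monoˡ-≤ 2 m≤c+2N) ⟩
        2 * beyond i j + (c + 2 * N + 2)  ≡⟨ rearrange (beyond i j) c N ⟩
        2 * (N + beyond i j + 1) + c      ≡⟨ cong (λ d → 2 * d + c) (trans (degree-split ij) (regular j)) ⟩
        2 * r + c                         ∎
        where
        N = commonNbrs G i j
        m≤c+2N : m ≤ c + 2 * N
        m≤c+2N = subst (m ≤_) (weight-adj c ij) (m≤weight j (adj⇒≢ G ij))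

  coDegree-bound : ∀ {r} → IsRegular G r → 1 ≤ r → ∀ c m i → r ≤ m →
    (∀ k → k ≢ i → m ≤ weight c i k) → coDegree i + (m + 2) ≤ 2 * r + c
  coDegree-bound {r} regular r≥1 c m i r≤m m≤weight = *-cancelˡ-≤ r {{>-nonZero r≥1}} (begin
    r * (T + (m + 2))              ≡⟨ *-distribˡ-+ r T (m + 2) ⟩
    r * T + r * (m + 2)            ≤⟨ +-monoˡ-≤ (r * (m + 2)) (≤-trans (≤-reflexive (*-comm r T)) (*-monoʳ-≤ T r≤m)) ⟩
    T * m + r * (m + 2)            ≤⟨ +-monoˡ-≤ (r * (m + 2)) (coDegree*m≤2*outerPaths c m i m≤weight) ⟩
    2 * outerPaths i + r * (m + 2) ≤⟨ 2*outerPaths+r*[m+2]≤r*[2r+c] c m i m≤weight regular ⟩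
    r * (2 * r + c)                ∎)
    where
    open ≤-Reasoning
    T = coDegree i

  minWeight-dichotomy : ∀ {r} → IsRegular G r → 1 ≤ r → ∀ c i →
    minOthers G (weight c) i ≤ r ⊎ coDegree i + (minOthers G (weight c) i + 2) ≤ 2 * r + c
  minWeight-dichotomy {r} regular r≥1 c i with ≤-total (minOthers G (weight c) i) r
  ... | inj₁ M≤r = inj₁ M≤r
  ... | inj₂ r≤M = inj₂ (coDegree-bound regular r≥1 c _ i r≤M (minOthers-≤ (weight c) i))

regular-pos : ∀ {n r} (G : SimpleGraph n) → n ≥ 2 → Connected G → IsRegular G r → 1 ℕ.≤ r
regular-pos {ℕ.zero}          G ()
regular-pos {ℕ.suc ℕ.zero}    G (ℕ.s≤s ())
regular-pos {ℕ.suc (ℕ.suc n)} G _ connected regular with connected zero (suc zero)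
... | there 0∼k _ = ≡.subst (1 ℕ.≤_) (regular zero) (Counting.degree-pos G 0∼k)

module OrderedFieldProperties {c ℓ} (F : OrderedField c ℓ) where
  open OrderedField F hiding (zero) renaming (+-mono-≤ to +-monoˡ-≤; _≤_ to infix 4 _≤_)
  open FieldOps F using (fromℕ)
  open import Algebra.Properties.Ring ring public
    using (-‿distribˡ-*; -‿distribʳ-*; -‿involutive; -‿injective; -‿+-comm; -0#≈0#;
           +-inverseʳ-unique; x∙y⁻¹≈ε⇒x≈y)
  open IsTotalOrder isTotalOrder public
    using (total; antisym; ≤-respˡ-≈; ≤-respʳ-≈)
    renaming (refl to ≤-refl; trans to ≤-trans)

  poset : Poset c ℓ ℓ
  poset = record { isPartialOrder = IsTotalOrder.isPartialOrder isTotalOrder }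

  module ≤-Reasoning = PartialOrderReasoning poset
  open ≤-Reasoning

  infix 4 ∣_∣≤_
  ∣_∣≤_ : Carrier → Carrier → Set ℓ
  ∣ x ∣≤ y = (- y ≤ x) × (x ≤ y)

  -x+[x+y]≈y : ∀ x y → - x + (x + y) ≈ y
  -x+[x+y]≈y x y = trans (sym (+-assoc (- x) x y)) (trans (+-congʳ (-‿inverseˡ x)) (+-identityˡ y))

  +-monoʳ-≤ : ∀ z {x y} → x ≤ y → z + x ≤ z + y
  +-monoʳ-≤ z {x} {y} x≤y = begin
    z + x  ≈⟨ +-comm z x ⟩
    x + z  ≤⟨ +-monoˡ-≤ z x≤y ⟩
    y + z  ≈⟨ +-comm y z ⟩
    z + y  ∎

  +-mono-≤ : ∀ {x y u v} → x ≤ y → u ≤ v → x + u ≤ y + v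
  +-mono-≤ {y = y} {u} x≤y u≤v = ≤-trans (+-monoˡ-≤ u x≤y) (+-monoʳ-≤ y u≤v)

  +-cancelˡ-≤ : ∀ z {x y} → z + x ≤ z + y → x ≤ y
  +-cancelˡ-≤ z {x} {y} z+x≤z+y = begin
    x              ≈⟨ -x+[x+y]≈y z x ⟨
    - z + (z + x)  ≤⟨ +-monoʳ-≤ (- z) z+x≤z+y ⟩
    - z + (z + y)  ≈⟨ -x+[x+y]≈y z y ⟩
    y              ∎

  neg-antimono-≤ : ∀ {x y} → x ≤ y → - y ≤ - x
  neg-antimono-≤ {x} {y} x≤y = +-cancelˡ-≤ x (begin
    x + - y  ≤⟨ +-monoˡ-≤ (- y) x≤y ⟩
    y + - y  ≈⟨ -‿inverseʳ y ⟩
    0#       ≈⟨ -‿inverseʳ x ⟨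
    x + - x  ∎)

  x≤0⇒0≤-x : ∀ {x} → x ≤ 0# → 0# ≤ - x
  x≤0⇒0≤-x x≤0 = ≤-respˡ-≈ -0#≈0# (neg-antimono-≤ x≤0)

  -y≤x⇒0≤y+x : ∀ {x y} → - y ≤ x → 0# ≤ y + x
  -y≤x⇒0≤y+x {x} {y} -y≤x = ≤-respˡ-≈ (-‿inverseʳ y) (+-monoʳ-≤ y -y≤x)

  -x≤x⇒0≤x : ∀ {x} → - x ≤ x → 0# ≤ x
  -x≤x⇒0≤x {x} -x≤x with total 0# x
  ... | inj₁ 0≤x = 0≤x
  ... | inj₂ x≤0 = ≤-trans (x≤0⇒0≤-x x≤0) -x≤x

  ∣∣≤0⇒≈0 : ∀ {x y} → ∣ x ∣≤ y → y ≈ 0# → x ≈ 0#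
  ∣∣≤0⇒≈0 {x} {y} (-y≤x , x≤y) y≈0 =
    antisym (≤-respʳ-≈ y≈0 x≤y) (≤-respˡ-≈ (trans (-‿cong y≈0) -0#≈0#) -y≤x)

  ∣-∣≤ : ∀ {x y} → ∣ - x ∣≤ y → ∣ x ∣≤ y
  ∣-∣≤ {x} {y} (-y≤-x , -x≤y) =
    ≤-respʳ-≈ (-‿involutive x) (neg-antimono-≤ -x≤y) ,
    ≤-respʳ-≈ (-‿involutive y) (≤-respˡ-≈ (-‿involutive x) (neg-antimono-≤ -y≤-x))

  0≤1 : 0# ≤ 1#
  0≤1 with total 0# 1#
  ... | inj₁ 0≤1 = 0≤1
  ... | inj₂ 1≤0 = ≤-respʳ-≈ [-1][-1]≈1 (*-nonneg (x≤0⇒0≤-x 1≤0) (x≤0⇒0≤-x 1≤0))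
    where
    [-1][-1]≈1 : - 1# * - 1# ≈ 1#
    [-1][-1]≈1 = trans (sym (-‿distribˡ-* 1# (- 1#))) (trans (-‿cong (*-identityˡ (- 1#))) (-‿involutive 1#))

  *-monoˡ-≤-nonNeg : ∀ {z x y} → 0# ≤ z → x ≤ y → z * x ≤ z * y
  *-monoˡ-≤-nonNeg {z} {x} {y} 0≤z x≤y = +-cancelˡ-≤ (- (z * x)) (begin
    - (z * x) + z * x  ≈⟨ -‿inverseˡ (z * x) ⟩
    0#                 ≤⟨ *-nonneg 0≤z 0≤y-x ⟩
    z * (y + - x)      ≈⟨ distribˡ z y (- x) ⟩
    z * y + z * - x    ≈⟨ +-comm _ _ ⟩
    z * - x + z * y    ≈⟨ +-congʳ (-‿distribʳ-* z x) ⟨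
    - (z * x) + z * y  ∎)
    where
    0≤y-x : 0# ≤ y + - x
    0≤y-x = ≤-respˡ-≈ (-‿inverseʳ x) (+-monoˡ-≤ (- x) x≤y)

  ⁻¹-cancelˡ : ∀ {x} → ¬ x ≈ 0# → ∀ y → x ⁻¹ * (x * y) ≈ y
  ⁻¹-cancelˡ {x} x≉0 y = begin-equality
    x ⁻¹ * (x * y)  ≈⟨ *-assoc (x ⁻¹) x y ⟨
    x ⁻¹ * x * y    ≈⟨ *-congʳ (trans (*-comm (x ⁻¹) x) (⁻¹-inverse x x≉0)) ⟩
    1# * y          ≈⟨ *-identityˡ y ⟩
    y               ∎

  ⁻¹-cancelʳ : ∀ {x} → ¬ x ≈ 0# → ∀ y → x * (x ⁻¹ * y) ≈ y
  ⁻¹-cancelʳ {x} x≉0 y =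
    trans (sym (*-assoc x (x ⁻¹) y)) (trans (*-congʳ (⁻¹-inverse x x≉0)) (*-identityˡ y))

  *-zero-divisor : ∀ {x y} → ¬ x ≈ 0# → x * y ≈ 0# → y ≈ 0#
  *-zero-divisor {x} {y} x≉0 xy≈0 =
    trans (sym (⁻¹-cancelˡ x≉0 y)) (trans (*-congˡ xy≈0) (zeroʳ (x ⁻¹)))

  ⁻¹-nonNeg : ∀ {x} → 0# ≤ x → ¬ x ≈ 0# → 0# ≤ x ⁻¹
  ⁻¹-nonNeg {x} 0≤x x≉0 with total 0# (x ⁻¹)
  ... | inj₁ 0≤x⁻¹ = 0≤x⁻¹
  ... | inj₂ x⁻¹≤0 = case 0≉1 (antisym 0≤1 1≤0) of λ ()
    where
    1≤0 : 1# ≤ 0#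
    1≤0 = begin
      1#        ≈⟨ ⁻¹-inverse x x≉0 ⟨
      x * x ⁻¹  ≤⟨ *-monoˡ-≤-nonNeg 0≤x x⁻¹≤0 ⟩
      x * 0#    ≈⟨ zeroʳ x ⟩
      0#        ∎

  *-cancelʳ-≤-pos : ∀ {w x y} → 0# ≤ w → ¬ w ≈ 0# → x * w ≤ y * w → x ≤ y
  *-cancelʳ-≤-pos {w} {x} {y} 0≤w w≉0 xw≤yw = begin
    x               ≈⟨ ⁻¹-cancelˡ w≉0 x ⟨
    w ⁻¹ * (w * x)  ≈⟨ *-congˡ (*-comm w x) ⟩
    w ⁻¹ * (x * w)  ≤⟨ *-monoˡ-≤-nonNeg (⁻¹-nonNeg 0≤w w≉0) xw≤yw ⟩
    w ⁻¹ * (y * w)  ≈⟨ *-congˡ (*-comm y w) ⟩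
    w ⁻¹ * (w * y)  ≈⟨ ⁻¹-cancelˡ w≉0 y ⟩
    y               ∎

  ≤-shiftˡ : ∀ {x y z w} → x + y ≤ z → 0# ≤ y + w → x ≤ z + w
  ≤-shiftˡ {x} {y} {z} {w} x+y≤z 0≤y+w = begin
    x            ≈⟨ +-identityʳ x ⟨
    x + 0#       ≤⟨ +-monoʳ-≤ x 0≤y+w ⟩
    x + (y + w)  ≈⟨ +-assoc x y w ⟨
    x + y + w    ≤⟨ +-monoˡ-≤ w x+y≤z ⟩
    z + w        ∎

  ≤-shiftʳ : ∀ {d w x y z} → d + w ≤ y → y + x ≤ d + z → w + x ≤ z
  ≤-shiftʳ {d} {w} {x} {y} {z} d+w≤y y+x≤d+z = +-cancelˡ-≤ d (begin
    d + (w + x)  ≈⟨ +-assoc d w x ⟨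
    d + w + x    ≤⟨ +-monoˡ-≤ x d+w≤y ⟩
    y + x        ≤⟨ y+x≤d+z ⟩
    d + z        ∎)

  x≤y+z⇒-y+x≤z : ∀ {x y z} → x ≤ y + z → - y + x ≤ z
  x≤y+z⇒-y+x≤z {x} {y} {z} x≤y+z = ≤-respʳ-≈ (-x+[x+y]≈y y z) (+-monoʳ-≤ (- y) x≤y+z)

  x+y≤z⇒x≤z-y : ∀ {x y z} → x + y ≤ z → x ≤ z + - y
  x+y≤z⇒x≤z-y {x} {y} {z} x+y≤z = begin
    x              ≈⟨ +-identityʳ x ⟨
    x + 0#         ≈⟨ +-congˡ (-‿inverseʳ y) ⟨
    x + (y + - y)  ≈⟨ +-assoc x y (- y) ⟨
    x + y + - y    ≤⟨ +-monoˡ-≤ (- y) x+y≤z ⟩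
    z + - y        ∎

  ≤-*⇒⁻¹-*-≤ : ∀ {ρ x y} → 0# ≤ ρ → ¬ ρ ≈ 0# → x ≤ ρ * y → ρ ⁻¹ * x ≤ y
  ≤-*⇒⁻¹-*-≤ {ρ} {x} {y} 0≤ρ ρ≉0 x≤ρy =
    ≤-respʳ-≈ (⁻¹-cancelˡ ρ≉0 y) (*-monoˡ-≤-nonNeg (⁻¹-nonNeg 0≤ρ ρ≉0) x≤ρy)

  divide-lower : ∀ {ρ t x λ′} → 0# ≤ ρ → ¬ ρ ≈ 0# → x ≤ t * ρ + ρ * λ′ → - t + ρ ⁻¹ * x ≤ λ′
  divide-lower {ρ} {t} {x} {λ′} 0≤ρ ρ≉0 x≤tρ+ρλ =
    x≤y+z⇒-y+x≤z (≤-*⇒⁻¹-*-≤ 0≤ρ ρ≉0 (≤-respʳ-≈ tρ+ρλ≈ρ[t+λ] x≤tρ+ρλ))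
    where
    tρ+ρλ≈ρ[t+λ] : t * ρ + ρ * λ′ ≈ ρ * (t + λ′)
    tρ+ρλ≈ρ[t+λ] = trans (+-congʳ (*-comm t ρ)) (sym (distribˡ ρ t λ′))

  divide-upper : ∀ {ρ t x λ′} → 0# ≤ ρ → ¬ ρ ≈ 0# → ρ * λ′ + x ≤ t * ρ → λ′ ≤ t + - (ρ ⁻¹ * x)
  divide-upper {ρ} {t} {x} {λ′} 0≤ρ ρ≉0 ρλ+x≤tρ =
    x+y≤z⇒x≤z-y (≤-respˡ-≈ ρ⁻¹[ρλ+x]≈λ+ρ⁻¹x (≤-*⇒⁻¹-*-≤ 0≤ρ ρ≉0 (≤-respʳ-≈ (*-comm t ρ) ρλ+x≤tρ)))
    where
    ρ⁻¹[ρλ+x]≈λ+ρ⁻¹x : ρ ⁻¹ * (ρ * λ′ + x) ≈ λ′ + ρ ⁻¹ * x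
    ρ⁻¹[ρλ+x]≈λ+ρ⁻¹x = trans (distribˡ (ρ ⁻¹) (ρ * λ′) x) (+-congʳ (⁻¹-cancelˡ ρ≉0 λ′))

  fromℕ-+ : ∀ m n → fromℕ (m ℕ.+ n) ≈ fromℕ m + fromℕ n
  fromℕ-+ ℕ.zero    n = sym (+-identityˡ (fromℕ n))
  fromℕ-+ (ℕ.suc m) n = trans (+-congˡ (fromℕ-+ m n)) (sym (+-assoc 1# (fromℕ m) (fromℕ n)))

  fromℕ-* : ∀ m n → fromℕ (m ℕ.* n) ≈ fromℕ m * fromℕ n
  fromℕ-* ℕ.zero    n = sym (zeroˡ (fromℕ n))
  fromℕ-* (ℕ.suc m) n = begin-equality
    fromℕ (n ℕ.+ m ℕ.* n)             ≈⟨ fromℕ-+ n (m ℕ.* n) ⟩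
    fromℕ n + fromℕ (m ℕ.* n)         ≈⟨ +-cong (sym (*-identityˡ (fromℕ n))) (fromℕ-* m n) ⟩
    1# * fromℕ n + fromℕ m * fromℕ n  ≈⟨ distribʳ (fromℕ n) 1# (fromℕ m) ⟨
    (1# + fromℕ m) * fromℕ n          ∎

  fromℕ-nonNeg : ∀ n → 0# ≤ fromℕ n
  fromℕ-nonNeg ℕ.zero    = ≤-refl
  fromℕ-nonNeg (ℕ.suc n) = ≤-respˡ-≈ (+-identityˡ 0#) (+-mono-≤ 0≤1 (fromℕ-nonNeg n))

  fromℕ-mono-≤ : ∀ {m n} → m ℕ.≤ n → fromℕ m ≤ fromℕ n
  fromℕ-mono-≤ {m} {n} m≤n = begin
    fromℕ m                    ≈⟨ +-identityʳ (fromℕ m) ⟨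
    fromℕ m + 0#               ≤⟨ +-monoʳ-≤ (fromℕ m) (fromℕ-nonNeg (n ℕ.∸ m)) ⟩
    fromℕ m + fromℕ (n ℕ.∸ m)  ≈⟨ fromℕ-+ m (n ℕ.∸ m) ⟨
    fromℕ (m ℕ.+ (n ℕ.∸ m))    ≡⟨ ≡.cong fromℕ (ℕ.m+[n∸m]≡n m≤n) ⟩
    fromℕ n                    ∎

  fromℕ-+-mono-≤ : ∀ {a b d} → a ℕ.+ b ℕ.≤ d → fromℕ a + fromℕ b ≤ fromℕ d
  fromℕ-+-mono-≤ {a} {b} a+b≤d = ≤-respˡ-≈ (fromℕ-+ a b) (fromℕ-mono-≤ a+b≤d)

  fromℕ-pos≉0 : ∀ {n} → 1 ℕ.≤ n → ¬ fromℕ n ≈ 0#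
  fromℕ-pos≉0 {ℕ.suc n} _ 1+n≈0 = 0≉1 (antisym 0≤1 (begin
    1#               ≈⟨ +-identityʳ 1# ⟨
    1# + 0#          ≤⟨ +-monoʳ-≤ 1# (fromℕ-nonNeg n) ⟩
    fromℕ (ℕ.suc n)  ≈⟨ 1+n≈0 ⟩
    0#               ∎))

module FieldSums {c ℓ} (F : OrderedField c ℓ) where
  open OrderedField F hiding (zero) renaming (+-mono-≤ to +-monoˡ-≤; _≤_ to infix 4 _≤_)
  open FieldOps F
  open OrderedFieldProperties F
  open IndicatorSums semiring public
  open NatSums using (count)

  Σ≡sum : ∀ {n} (f : Fin n → Carrier) → Σ[ f ] ≡ sum f
  Σ≡sum {ℕ.zero}  f = ≡.refl
  Σ≡sum {ℕ.suc n} f = ≡.cong (f zero +_) (Σ≡sum (f ∘ suc))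

  when-mono-≤ : ∀ b {x y} → x ≤ y → when b x ≤ when b y
  when-mono-≤ true  x≤y = x≤y
  when-mono-≤ false x≤y = ≤-refl

  when-neg : ∀ b x → when b (- x) ≈ - when b x
  when-neg true  x = refl
  when-neg false x = sym -0#≈0#

  sum-mono-≤ : ∀ {n} {f g : Fin n → Carrier} → (∀ k → f k ≤ g k) → sum f ≤ sum g
  sum-mono-≤ {ℕ.zero}  f≤g = ≤-refl
  sum-mono-≤ {ℕ.suc n} f≤g = +-mono-≤ (f≤g zero) (sum-mono-≤ (f≤g ∘ suc))

  sum-neg : ∀ {n} (f : Fin n → Carrier) → sum (λ k → - f k) ≈ - sum f
  sum-neg {ℕ.zero}  f = sym -0#≈0#
  sum-neg {ℕ.suc n} f = trans (+-congˡ (sum-neg (f ∘ suc))) (-‿+-comm (f zero) (sum (f ∘ suc)))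

  sum-when-const : ∀ {n} (p : Fin n → Bool) x → sum (λ k → when (p k) x) ≈ fromℕ (count p) * x
  sum-when-const {ℕ.zero}  p x = sym (zeroˡ x)
  sum-when-const {ℕ.suc n} p x with p zero
  ... | true  = trans (+-cong (sym (*-identityˡ x)) (sum-when-const (p ∘ suc) x)) (sym (distribʳ x 1# _))
  ... | false = trans (+-identityˡ _) (sum-when-const (p ∘ suc) x)

module Gershgorin {c ℓ} (F : OrderedField c ℓ) {n : ℕ} where
  open OrderedField F hiding (zero) renaming (+-mono-≤ to +-monoˡ-≤; _≤_ to infix 4 _≤_)
  open FieldOps F
  open OrderedFieldProperties F
  open FieldSums F
  open NatSums using (count)
  open ≤-Reasoning

  IsEigenvector : (Fin n → Fin n → Bool) → Carrier → (Fin n → Carrier) → Set ℓ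
  IsEigenvector P θ w = ∀ j → sum (λ k → when (P j k) (w k)) ≈ θ * w j

  eigenvector-neg : ∀ {P θ w} → IsEigenvector P θ w → IsEigenvector P θ (λ k → - w k)
  eigenvector-neg {P} {θ} {w} eigen j = begin-equality
    sum (λ k → when (P j k) (- w k))  ≈⟨ sum-cong-≋ (λ k → when-neg (P j k) (w k)) ⟩
    sum (λ k → - when (P j k) (w k))  ≈⟨ sum-neg (λ k → when (P j k) (w k)) ⟩
    - sum (λ k → when (P j k) (w k))  ≈⟨ -‿cong (eigen j) ⟩
    - (θ * w j)                       ≈⟨ -‿distribʳ-* θ (w j) ⟩
    θ * - w j                         ∎

  DominantAt : (Fin n → Carrier) → Fin n → Set ℓ
  DominantAt w j = ¬ w j ≈ 0# × (∀ k → ∣ w k ∣≤ w j)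

  gershgorin : ∀ (p : Fin n → Bool) {w j θ} → DominantAt w j →
    sum (λ k → when (p k) (w k)) ≈ θ * w j → ∣ θ ∣≤ fromℕ (count p)
  gershgorin p {w} {j} {θ} (wj≉0 , dominant) eigen = lower , upper
    where
    C = fromℕ (count p)
    cancel : ∀ {x y} → x * w j ≤ y * w j → x ≤ y
    cancel = *-cancelʳ-≤-pos (-x≤x⇒0≤x (proj₁ (dominant j))) wj≉0
    upper : θ ≤ C
    upper = cancel (begin
      θ * w j                       ≈⟨ eigen ⟨
      sum (λ k → when (p k) (w k))  ≤⟨ sum-mono-≤ (λ k → when-mono-≤ (p k) (proj₂ (dominant k))) ⟩
      sum (λ k → when (p k) (w j))  ≈⟨ sum-when-const p (w j) ⟩
      C * w j                       ∎)
    lower : - C ≤ θ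
    lower = cancel (begin
      - C * w j                       ≈⟨ -‿distribˡ-* C (w j) ⟨
      - (C * w j)                     ≈⟨ -‿distribʳ-* C (w j) ⟩
      C * - w j                       ≈⟨ sum-when-const p (- w j) ⟨
      sum (λ k → when (p k) (- w j))  ≤⟨ sum-mono-≤ (λ k → when-mono-≤ (p k) (proj₁ (dominant k))) ⟩
      sum (λ k → when (p k) (w k))    ≈⟨ eigen ⟩
      θ * w j                         ∎)

  dominant-entry : ∀ (v : Fin n → Carrier) {j₀} → ¬ v j₀ ≈ 0# →
    ∃ (DominantAt v) ⊎ ∃ (DominantAt (λ k → - v k))
  dominant-entry v {j₀} vj₀≉0 = case total (- v jmax) (v jmin) of λ where
      (inj₁ -vmax≤vmin) → inj₁ (jmax , dominantAt (bound-by-max -vmax≤vmin) vj₀≉0)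
      (inj₂ vmin≤-vmax) → inj₂ (jmin , dominantAt (bound-by-min vmin≤-vmax) (vj₀≉0 ∘ -x≈0⇒x≈0))
    where
    totalOrder : TotalOrder c ℓ ℓ
    totalOrder = record { isTotalOrder = isTotalOrder }
    open import Data.List.Extrema totalOrder using (argmax; argmin; f[xs]≤f[argmax]; f[argmin]≤f[xs])
    jmax = argmax v j₀ (allFin n)
    jmin = argmin v j₀ (allFin n)
    ≤max : ∀ k → v k ≤ v jmax
    ≤max k = All.lookup (f[xs]≤f[argmax] j₀ (allFin n)) (∈-allFin k)
    min≤ : ∀ k → v jmin ≤ v k
    min≤ k = All.lookup (f[argmin]≤f[xs] j₀ (allFin n)) (∈-allFin k)
    bound-by-max : - v jmax ≤ v jmin → ∀ k → ∣ v k ∣≤ v jmax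
    bound-by-max -vmax≤vmin k = ≤-trans -vmax≤vmin (min≤ k) , ≤max k
    bound-by-min : v jmin ≤ - v jmax → ∀ k → ∣ - v k ∣≤ - v jmin
    bound-by-min vmin≤-vmax k = neg-antimono-≤ (≤-trans (≤max k) vmax≤-vmin) , neg-antimono-≤ (min≤ k)
      where
      vmax≤-vmin : v jmax ≤ - v jmin
      vmax≤-vmin = ≤-respˡ-≈ (-‿involutive (v jmax)) (neg-antimono-≤ vmin≤-vmax)
    -x≈0⇒x≈0 : ∀ {x} → - x ≈ 0# → x ≈ 0#
    -x≈0⇒x≈0 -x≈0 = -‿injective (trans -x≈0 (sym -0#≈0#))
    dominantAt : ∀ {w j} → (∀ k → ∣ w k ∣≤ w j) → ¬ w j₀ ≈ 0# → DominantAt w j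
    dominantAt bound wj₀≉0 = (λ wj≈0 → wj₀≉0 (∣∣≤0⇒≈0 (bound j₀) wj≈0)) , bound

  common-eigenvector-bounds : ∀ {P Q μ θ v j₀} →
    IsEigenvector P μ v → IsEigenvector Q θ v → ¬ v j₀ ≈ 0# →
    ∃ λ j → ∣ μ ∣≤ fromℕ (count (P j)) × ∣ θ ∣≤ fromℕ (count (Q j))
  common-eigenvector-bounds {P} {Q} {v = v} Pv Qv vj₀≉0 with dominant-entry v vj₀≉0
  ... | inj₁ (j , dom) = j , gershgorin (P j) dom (Pv j) , gershgorin (Q j) dom (Qv j)
  ... | inj₂ (j , dom) =
    j , gershgorin (P j) dom (eigenvector-neg Pv j) , gershgorin (Q j) dom (eigenvector-neg Qv j)

module RegularGraphSpectrum {c ℓ} (F : OrderedField c ℓ) {n : ℕ} (G : SimpleGraph n) {r : ℕ}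
                            (regular : IsRegular G r) (r≥1 : 1 ℕ.≤ r) where
  open OrderedField F hiding (zero) renaming (+-mono-≤ to +-monoˡ-≤; _≤_ to infix 4 _≤_)
  open FieldOps F
  open OrderedFieldProperties F
  open FieldSums F
  open Gershgorin F
  open SimpleGraph G renaming (sym to Adj-sym)
  open NatSums using (count)
  open Counting G using (count-Adj; coDegree; coDegree-regular; minWeight-dichotomy)
  open MinMax G using (maxMin-preserves)
  open import Relation.Nullary.Decidable using (isYes≗does)
  open import Data.Nat.Tactic.RingSolver using (solve-∀)

  ρ : Carrier
  ρ = fromℕ r

  ρ≉0 : ¬ ρ ≈ 0#
  ρ≉0 = fromℕ-pos≉0 r≥1

  R-entry : ∀ i k x → R G i k * x ≈ ρ ⁻¹ * when (Adj i k) x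
  R-entry i k x = begin-equality
    R G i k * x                   ≡⟨ ≡.cong (λ d → d ⁻¹ * adjMatrix G i k * x) degMatrix-diag ⟩
    ρ ⁻¹ * adjMatrix G i k * x    ≈⟨ *-assoc (ρ ⁻¹) (adjMatrix G i k) x ⟩
    ρ ⁻¹ * (adjMatrix G i k * x)  ≈⟨ *-congˡ (indicator-* (Adj i k)) ⟩
    ρ ⁻¹ * when (Adj i k) x       ∎
    where
    open ≤-Reasoning
    degMatrix-diag : degMatrix G i i ≡ ρ
    degMatrix-diag = ≡.trans (≡.cong (λ b → if b then fromℕ (degree G i) else 0#)
                                     (≡.trans (isYes≗does (i ≟ i)) (dec-true (i ≟ i) ≡.refl)))
                             (≡.cong fromℕ (regular i))
    indicator-* : ∀ b → (if b then 1# else 0#) * x ≈ when b x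
    indicator-* true  = *-identityˡ x
    indicator-* false = zeroˡ x

  adjacency-eigenvector : ∀ {λ′ v} → (∀ i → Σ[ (λ j → R G i j * v j) ] ≈ λ′ * v i) →
                          IsEigenvector Adj (ρ * λ′) v
  adjacency-eigenvector {λ′} {v} eigen i = begin-equality
    sum A                           ≈⟨ ⁻¹-cancelʳ ρ≉0 (sum A) ⟨
    ρ * (ρ ⁻¹ * sum A)              ≈⟨ *-congˡ (*-distribˡ-sum (ρ ⁻¹) A) ⟩
    ρ * sum (λ k → ρ ⁻¹ * A k)      ≈⟨ *-congˡ (sum-cong-≋ (λ k → R-entry i k (v k))) ⟨
    ρ * sum (λ k → R G i k * v k)   ≡⟨ ≡.cong (ρ *_) (Σ≡sum (λ k → R G i k * v k)) ⟨
    ρ * Σ[ (λ k → R G i k * v k) ]  ≈⟨ *-congˡ (eigen i) ⟩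
    ρ * (λ′ * v i)                  ≈⟨ *-assoc ρ λ′ (v i) ⟨
    ρ * λ′ * v i                    ∎
    where
    open ≤-Reasoning
    A : Fin n → Carrier
    A k = when (Adj i k) (v k)

  ρ*sum≈∑-rows : ∀ (v : Fin n → Carrier) → ρ * sum v ≈ sum (λ i → sum (λ k → when (Adj i k) (v k)))
  ρ*sum≈∑-rows v = begin-equality
    ρ * sum v                                     ≈⟨ *-distribˡ-sum ρ v ⟩
    sum (λ k → ρ * v k)                           ≈⟨ sum-cong-≋ column ⟨
    sum (λ k → sum (λ i → when (Adj i k) (v k)))  ≈⟨ ∑-comm (λ k i → when (Adj i k) (v k)) ⟩
    sum (λ i → sum (λ k → when (Adj i k) (v k)))  ∎
    where
    open ≤-Reasoning
    column : ∀ k → sum (λ i → when (Adj i k) (v k)) ≈ ρ * v k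
    column k = begin-equality
      sum (λ i → when (Adj i k) (v k))  ≡⟨ sum-cong-≗ (λ i → ≡.cong (λ b → when b (v k)) (Adj-sym i k)) ⟩
      sum (λ i → when (Adj k i) (v k))  ≈⟨ sum-when-const (Adj k) (v k) ⟩
      fromℕ (count (Adj k)) * v k       ≡⟨ ≡.cong (λ d → fromℕ d * v k) (count-Adj regular k) ⟩
      ρ * v k                           ∎

  eigenvector-sum-zero : ∀ {μ v} → IsEigenvector Adj μ v → ¬ μ ≈ ρ → sum v ≈ 0#
  eigenvector-sum-zero {μ} {v} eigen μ≉ρ = *-zero-divisor ρ-μ≉0 (begin-equality
    (ρ + - μ) * sum v          ≈⟨ distribʳ (sum v) ρ (- μ) ⟩
    ρ * sum v + - μ * sum v    ≈⟨ +-cong ρ*sum≈μ*sum (sym (-‿distribˡ-* μ (sum v))) ⟩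
    μ * sum v + - (μ * sum v)  ≈⟨ -‿inverseʳ (μ * sum v) ⟩
    0#                         ∎)
    where
    open ≤-Reasoning
    ρ-μ≉0 : ¬ ρ + - μ ≈ 0#
    ρ-μ≉0 ρ-μ≈0 = μ≉ρ (sym (x∙y⁻¹≈ε⇒x≈y ρ μ ρ-μ≈0))
    ρ*sum≈μ*sum : ρ * sum v ≈ μ * sum v
    ρ*sum≈μ*sum = begin-equality
      ρ * sum v                                     ≈⟨ ρ*sum≈∑-rows v ⟩
      sum (λ i → sum (λ k → when (Adj i k) (v k)))  ≈⟨ sum-cong-≋ eigen ⟩
      sum (λ i → μ * v i)                           ≈⟨ *-distribˡ-sum μ v ⟨
      μ * sum v                                     ∎

  complement-eigenvector : ∀ {μ v} → IsEigenvector Adj μ v → sum v ≈ 0# →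
                           IsEigenvector (nonAdj G) (- (1# + μ)) v
  complement-eigenvector {μ} {v} eigen sum≈0 j = begin-equality
    N                   ≈⟨ +-inverseʳ-unique ((1# + μ) * v j) N [1+μ]vj+N≈0 ⟩
    - ((1# + μ) * v j)  ≈⟨ -‿distribˡ-* (1# + μ) (v j) ⟩
    - (1# + μ) * v j    ∎
    where
    open ≤-Reasoning
    N = sum (λ k → when (nonAdj G j k) (v k))
    [1+μ]vj+N≈0 : (1# + μ) * v j + N ≈ 0#
    [1+μ]vj+N≈0 = begin-equality
      (1# + μ) * v j + N                          ≈⟨ +-congʳ (distribʳ (v j) 1# μ) ⟩
      1# * v j + μ * v j + N                      ≈⟨ +-congʳ (+-congʳ (*-identityˡ (v j))) ⟩
      v j + μ * v j + N                           ≈⟨ +-assoc (v j) (μ * v j) N ⟩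
      v j + (μ * v j + N)                         ≈⟨ +-comm (v j) (μ * v j + N) ⟩
      μ * v j + N + v j                           ≈⟨ +-congʳ (+-congʳ (eigen j)) ⟨
      sum (λ k → when (Adj j k) (v k)) + N + v j  ≈⟨ sum-split-closedNbhd G j v ⟩
      sum v                                       ≈⟨ sum≈0 ⟩
      0#                                          ∎

  lower-small : ∀ {μ} M → ∣ μ ∣≤ ρ → M ℕ.≤ r → fromℕ M ≤ fromℕ (2 ℕ.* r) + μ
  lower-small M (-ρ≤μ , _) M≤r = ≤-shiftˡ (fromℕ-+-mono-≤ {M} {r} M+r≤2r) (-y≤x⇒0≤y+x -ρ≤μ)
    where
    M+r≤2r : M ℕ.+ r ℕ.≤ 2 ℕ.* r
    M+r≤2r = ≡.subst (M ℕ.+ r ℕ.≤_) (≡.cong (r ℕ.+_) (≡.sym (ℕ.+-identityʳ r))) (ℕ.+-monoˡ-≤ r M≤r)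

  lower-large : ∀ {μ} T M → ∣ 1# + μ ∣≤ fromℕ T → T ℕ.+ (M ℕ.+ 2) ℕ.≤ 2 ℕ.* r ℕ.+ 1 →
                fromℕ M ≤ fromℕ (2 ℕ.* r) + μ
  lower-large {μ} T M (-T≤1+μ , _) T+M+2≤2r+1 =
    ≤-shiftˡ (fromℕ-+-mono-≤ {M} {ℕ.suc T} M+1+T≤2r) (begin
      0#                   ≤⟨ -y≤x⇒0≤y+x -T≤1+μ ⟩
      fromℕ T + (1# + μ)   ≈⟨ +-assoc (fromℕ T) 1# μ ⟨
      fromℕ T + 1# + μ     ≈⟨ +-congʳ (+-comm (fromℕ T) 1#) ⟩
      fromℕ (ℕ.suc T) + μ  ∎)
    where
    open ≤-Reasoning
    lhs : ∀ T M → T ℕ.+ (M ℕ.+ 2) ≡ ℕ.suc (M ℕ.+ ℕ.suc T)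
    lhs = solve-∀
    rhs : ∀ r → 2 ℕ.* r ℕ.+ 1 ≡ ℕ.suc (2 ℕ.* r)
    rhs = solve-∀
    M+1+T≤2r : M ℕ.+ ℕ.suc T ℕ.≤ 2 ℕ.* r
    M+1+T≤2r = ℕ.≤-pred (≡.subst₂ ℕ._≤_ (lhs T M) (rhs r) T+M+2≤2r+1)

  upper-small : ∀ {μ} M → ∣ μ ∣≤ ρ → M ℕ.≤ r → μ + fromℕ M ≤ fromℕ (2 ℕ.* r)
  upper-small M (_ , μ≤ρ) M≤r = ≤-trans (+-monoˡ-≤ (fromℕ M) μ≤ρ) (fromℕ-+-mono-≤ {r} {M} r+M≤2r)
    where
    r+M≤2r : r ℕ.+ M ℕ.≤ 2 ℕ.* r
    r+M≤2r = ≡.subst (r ℕ.+ M ℕ.≤_) (≡.cong (r ℕ.+_) (≡.sym (ℕ.+-identityʳ r))) (ℕ.+-monoʳ-≤ r M≤r)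

  upper-large : ∀ {μ} T M → ∣ 1# + μ ∣≤ fromℕ T → T ℕ.+ (M ℕ.+ 2) ℕ.≤ 2 ℕ.* r ℕ.+ 3 →
                μ + fromℕ M ≤ fromℕ (2 ℕ.* r)
  upper-large T M (_ , 1+μ≤T) T+M+2≤2r+3 = ≤-shiftʳ 1+μ≤T (fromℕ-+-mono-≤ {T} {M} T+M≤1+2r)
    where
    lhs : ∀ T M → T ℕ.+ (M ℕ.+ 2) ≡ ℕ.suc (ℕ.suc (T ℕ.+ M))
    lhs = solve-∀
    rhs : ∀ r → 2 ℕ.* r ℕ.+ 3 ≡ ℕ.suc (ℕ.suc (ℕ.suc (2 ℕ.* r)))
    rhs = solve-∀
    T+M≤1+2r : T ℕ.+ M ℕ.≤ ℕ.suc (2 ℕ.* r)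
    T+M≤1+2r = ℕ.≤-pred (ℕ.≤-pred (≡.subst₂ ℕ._≤_ (lhs T M) (rhs r) T+M+2≤2r+3))

  module Eigenvalue {λ′ : Carrier} {v : Fin n → Carrier} {j₀ : Fin n} (vj₀≉0 : ¬ v j₀ ≈ 0#)
                    (eigen : ∀ i → Σ[ (λ j → R G i j * v j) ] ≈ λ′ * v i) (λ′≉1 : ¬ λ′ ≈ 1#) where

    μ : Carrier
    μ = ρ * λ′

    μ≉ρ : ¬ μ ≈ ρ
    μ≉ρ μ≈ρ = λ′≉1 (begin-equality
      λ′        ≈⟨ ⁻¹-cancelˡ ρ≉0 λ′ ⟨
      ρ ⁻¹ * μ  ≈⟨ *-congˡ μ≈ρ ⟩
      ρ ⁻¹ * ρ  ≈⟨ *-comm (ρ ⁻¹) ρ ⟩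
      ρ * ρ ⁻¹  ≈⟨ ⁻¹-inverse ρ ρ≉0 ⟩
      1#        ∎)
      where open ≤-Reasoning

    adjacency-eigen : IsEigenvector Adj μ v
    adjacency-eigen = adjacency-eigenvector eigen

    complement-eigen : IsEigenvector (nonAdj G) (- (1# + μ)) v
    complement-eigen = complement-eigenvector adjacency-eigen (eigenvector-sum-zero adjacency-eigen μ≉ρ)

    eigenvalue-bounds : ∣ μ ∣≤ ρ × (∀ i → ∣ 1# + μ ∣≤ fromℕ (coDegree i))
    eigenvalue-bounds with common-eigenvector-bounds adjacency-eigen complement-eigen vj₀≉0
    ... | j , ∣μ∣≤ , ∣-[1+μ]∣≤ =
      ≡.subst (λ d → ∣ μ ∣≤ fromℕ d) (count-Adj regular j) ∣μ∣≤ ,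
      λ i → ≡.subst (λ d → ∣ 1# + μ ∣≤ fromℕ d) (coDegree-regular regular j i) (∣-∣≤ ∣-[1+μ]∣≤)

    ∣μ∣≤ρ : ∣ μ ∣≤ ρ
    ∣μ∣≤ρ = proj₁ eigenvalue-bounds

    ∣1+μ∣≤coDegree : ∀ i → ∣ 1# + μ ∣≤ fromℕ (coDegree i)
    ∣1+μ∣≤coDegree = proj₂ eigenvalue-bounds

    Mγ-bound : fromℕ (Mγ G) ≤ fromℕ (2 ℕ.* r) + μ
    Mγ-bound = maxMin-preserves (λ M → fromℕ M ≤ fromℕ (2 ℕ.* r) + μ) (γ G) (lower-small 1 ∣μ∣≤ρ r≥1)
      λ i → [ lower-small _ ∣μ∣≤ρ , lower-large (coDegree i) _ (∣1+μ∣≤coDegree i) ]′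
              (minWeight-dichotomy regular r≥1 1 i)

    Mδ-bound : μ + fromℕ (Mδ G) ≤ fromℕ (2 ℕ.* r)
    Mδ-bound = maxMin-preserves (λ M → μ + fromℕ M ≤ fromℕ (2 ℕ.* r)) (δ G) (upper-small 1 ∣μ∣≤ρ r≥1)
      λ i → [ upper-small _ ∣μ∣≤ρ , upper-large (coDegree i) _ (∣1+μ∣≤coDegree i) ]′
              (minWeight-dichotomy regular r≥1 3 i)

corollary3p3 :
  ∀ {c ℓ} (F : OrderedField c ℓ) (n r : ℕ) (G : SimpleGraph n) →
  n ≥ 2 → Connected G → IsRegular G r →
  let open OrderedField F
      open FieldOps F
  in ∀ (λ′ : Carrier) → IsEigenvalueR G λ′ → ¬ (λ′ ≈ 1#) →
     (((- fromℕ 2) + ((fromℕ r ⁻¹) * fromℕ (Mγ G))) ≤ λ′)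
     × (λ′ ≤ (fromℕ 2 + (- ((fromℕ r ⁻¹) * fromℕ (Mδ G)))))
corollary3p3 F n r G n≥2 connected regular λ′ (v , (j₀ , vj₀≉0) , eigen) λ′≉1 =
  divide-lower (fromℕ-nonNeg r) ρ≉0 (≤-respʳ-≈ (+-congʳ (fromℕ-* 2 r)) Mγ-bound) ,
  divide-upper (fromℕ-nonNeg r) ρ≉0 (≤-respʳ-≈ (fromℕ-* 2 r) Mδ-bound)
  where
  open OrderedField F using (+-congʳ)
  open OrderedFieldProperties F using (fromℕ-nonNeg; fromℕ-*; ≤-respʳ-≈; divide-lower; divide-upper)
  open RegularGraphSpectrum F G regular (regular-pos G n≥2 connected regular)
  open Eigenvalue vj₀≉0 eigen λ′≉1
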